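{- Let $m$ be an integer and $n$ a positive integer. Let $Q_{m,n}$ be the set of doubly marked partitions of $n$ with spt-crank $m$, and let $V_{m,n}$ be the set of pairs of partitions $(\alpha,\beta)$ with $|\alpha|+|\beta|=n$, all parts of $\beta$ equal, such that (1) the rank-set of $\alpha$ contains $m$, and (2) if $j$ is the width of the $m$-Durfee rectangle of $\alpha$ and $h$ is the maximum integer with $\alpha_{j+m+1+h}\ge h$, then $\beta_1=j+m+1+h$. For $(\lambda,s,t)\in Q_{m,n}$ with $\lambda=(\lambda_1,\dots,\lambda_\ell)$ define $\psi(\lambda,s,t)=(\alpha,\beta)$ by $$\alpha=(\lambda_1-t+s-1,\ \dots,\ \lambda_{\lambda'_s}-t+s-1,\ \lambda_{\lambda'_s+1},\ \dots,\ \lambda_\ell),\qquad \beta=(\lambda'_s,\lambda'_{s+1},\dots,\lambda'_t).$$ Then $\psi$ is a bijection from $Q_{m,n}$ onto $V_{m,n}$.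
   Context: Partitions are written with weakly decreasing parts, with $\alpha_i=0$ for $i$ larger than the number of parts; $\lambda'$ is the conjugate of $\lambda$ (so $\lambda'_s$ is the number of parts of $\lambda$ that are $\ge s$), and $D(\lambda)$ is the side length of the Durfee square. A doubly marked partition of $n$ is a triple $(\lambda,s,t)$ with $\lambda$ a partition of $n$, $1\le s\le D(\lambda)$, $s\le t\le\lambda_1$, and $\lambda'_s=\lambda'_t$; with $g=\lambda'_s-s+1$, its spt-crank is $g-\lambda_g+t-s$. The rank-set of $\alpha=(\alpha_1,\dots,\alpha_\ell)$ is the sequence $[-\alpha_1,\,1-\alpha_2,\,\dots,\,\ell-1-\alpha_\ell,\,\ell,\,\ell+1,\dots]$. For an integer $m$ (possibly negative), the $m$-Durfee rectangle of $\alpha$ is the largest $(m+j)\times j$ rectangle ($m+j$ rows, $j$ columns) contained in the Ferrers diagram of $\alpha$, and $j$ is its width; if $\ell(\alpha)\le m$ the width is taken to be $0$. -}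

module Defs where

open import Data.Nat using (ℕ; zero; suc; _+_; _∸_; _≤_; _<_; _≤?_; _<?_)
open import Data.Integer as ℤ using (ℤ; +_)
open import Data.Nat.ListAction using (sum)
open import Relation.Nullary using (yes; no)
open import Data.List using (List; []; _∷_; length; filter; map; take; drop; _++_; applyUpTo)
open import Data.List.Relation.Unary.All using (All)
open import Data.List.Relation.Unary.Linked using (Linked)
open import Data.Product using (_×_; _,_; Σ; ∃)
open import Relation.Binary.PropositionalEquality using (_≡_)

IsPartition : List ℕ → Set
IsPartition xs = Linked (λ a b → b ≤ a) xs × All (λ a → 0 < a) xs

IsPartitionOf : ℕ → List ℕ → Set
IsPartitionOf n xs = IsPartition xs × sum xs ≡ n

-- part xs i = xs_i, 1-indexed, with xs_i = 0 for i larger than the number of parts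
-- (index 0 is unused and gives 0).
part : List ℕ → ℕ → ℕ
part [] _ = 0
part (x ∷ xs) zero = 0
part (x ∷ xs) (suc zero) = x
part (x ∷ xs) (suc (suc i)) = part xs (suc i)

conj : List ℕ → ℕ → ℕ
conj xs s = length (filter (s ≤?_) xs)

durfeeFrom : ℕ → List ℕ → ℕ
durfeeFrom i [] = 0
durfeeFrom i (x ∷ xs) with i ≤? x
... | yes _ = suc (durfeeFrom (suc i) xs)
... | no _ = 0

durfee : List ℕ → ℕ
durfee = durfeeFrom 1

IsDoublyMarked : ℕ → List ℕ → ℕ → ℕ → Set
IsDoublyMarked n la s t =
  IsPartitionOf n la × 1 ≤ s × s ≤ durfee la × s ≤ t × t ≤ part la 1 × conj la s ≡ conj la t

sptCrank : List ℕ → ℕ → ℕ → ℤ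
sptCrank la s t = (((+ g) ℤ.- (+ part la g)) ℤ.+ (+ t)) ℤ.- (+ s)
  where g = (conj la s ∸ s) + 1

IsQ : ℤ → ℕ → List ℕ → ℕ → ℕ → Set
IsQ m n la s t = IsDoublyMarked n la s t × sptCrank la s t ≡ m

-- rank-set of α, indexed from k = 0: [-α_1, 1-α_2, ..., ℓ-1-α_ℓ, ℓ, ℓ+1, ...]
rankSet : List ℕ → ℕ → ℤ
rankSet α k with suc k ≤? length α
... | yes _ = (+ k) ℤ.- (+ part α (suc k))
... | no _ = + k

InRankSet : ℤ → List ℕ → Set
InRankSet m α = ∃ λ k → rankSet α k ≡ m

-- an (m+j) × j rectangle (m+j rows, j columns) fits in the Ferrers diagram of α
RectFits : ℤ → List ℕ → ℕ → Set
RectFits m α j = Σ ℕ λ r → (+ r ≡ m ℤ.+ (+ j)) ×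
  (∀ i c → 1 ≤ i → i ≤ r → 1 ≤ c → c ≤ j → c ≤ part α i)

IsDurfeeRectWidth : ℤ → List ℕ → ℕ → Set
IsDurfeeRectWidth m α j = RectFits m α j × (∀ j' → RectFits m α j' → j' ≤ j)

HCond : ℤ → List ℕ → ℕ → ℕ → Set
HCond m α j h = Σ ℕ λ idx → (+ idx ≡ (((+ j) ℤ.+ m) ℤ.+ (+ 1)) ℤ.+ (+ h)) × h ≤ part α idx

IsMaxH : ℤ → List ℕ → ℕ → ℕ → Set
IsMaxH m α j h = HCond m α j h × (∀ h' → HCond m α j h' → h' ≤ h)

IsV : ℤ → ℕ → List ℕ × List ℕ → Set
IsV m n (α , β) =
  IsPartition α × IsPartition β × sum α + sum β ≡ n ×
  All (λ x → x ≡ part β 1) β ×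
  InRankSet m α ×
  (∀ j h → IsDurfeeRectWidth m α j → IsMaxH m α j h →
     + part β 1 ≡ (((+ j) ℤ.+ m) ℤ.+ (+ 1)) ℤ.+ (+ h))

-- ψ(λ,s,t) = (α, β); zero parts of α (which occur only when s = 1) are discarded
psi : List ℕ → ℕ → ℕ → List ℕ × List ℕ
psi la s t = (α , β)
  where
  k = conj la s
  α = filter (0 <?_) (map (λ x → ((x ∸ t) + s) ∸ 1) (take k la) ++ drop k la)
  β = applyUpTo (λ i → conj la (s + i)) (suc (t ∸ s))

module Submission where

-- Both sets are parametrised by the same data.  Call (α, i, h) admissible if α is a
-- partition with α_K ≥ h and α_{K+1} < h + 1, where K = i + 1 + h.
-- * Q side.  For (λ,s,t) ∈ Q_{m,n} the columns s, …, t of λ all have length K = λ'_s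
--   ("a block of equal columns"); ψ removes this block, leaving α, and records it as
--   β = (K,…,K).  Writing s = h + 1 and K = i + s, the triple (α,i,h) is admissible,
--   the spt-crank equals the rank-set entry i - α_{i+1}, and λ is α with the block glued
--   back (addColumns).  Conversely gluing c + 1 columns of height K onto an admissible α
--   gives a doubly marked partition whose ψ-image is (α, (K,…,K)).
-- * V side.  For m = i - α_{i+1} the m-Durfee rectangle of α has width α_{i+1} and the
--   maximal h of condition (2) is the h with α_K ≥ h > α_{K+1} - 1, so condition (2) says
--   exactly β = (K,…,K) with (α,i,h) admissible.
-- The record Glued packages this common description; both Q_{m,n} and V_{m,n} are shown
-- to correspond to it, and i, h, c are determined by (α, β, m) because i ↦ i - α_{i+1} is
-- injective.

open import Data.Nat using (ℕ; zero; suc; _+_; _∸_; _*_; _≤_; _<_; _≤?_; _<?_; z≤n; s≤s)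
open import Data.Nat.Properties
open import Data.Nat.ListAction using (sum)
open import Data.Nat.Tactic.RingSolver using (solve-∀)
open import Data.Integer as Z using (ℤ; +_)
import Data.Integer.Properties as ZP
import Data.Integer.Tactic.RingSolver as ZR
open import Data.List using (List; []; _∷_; length; filter; map; take; drop; _++_; applyUpTo; replicate)
open import Data.List.Properties using (length-filter; filter-accept; filter-reject; length-replicate)
open import Data.List.Relation.Unary.All using (All; []; _∷_)
open import Data.List.Relation.Unary.All.Properties using (all-filter; replicate⁺)
open import Data.List.Relation.Unary.Linked using (Linked; []; [-]; _∷_)
import Data.List.Relation.Unary.Linked as Linked
import Data.List.Relation.Unary.Linked.Properties as LinkedP
open import Data.Product using (_×_; _,_; Σ; proj₁; proj₂)
open import Data.Sum using (inj₁; inj₂)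
open import Data.Empty using (⊥-elim)
open import Relation.Nullary using (yes; no; ¬_; Dec)
open import Relation.Binary.Definitions using (tri<; tri≈; tri>)
open import Relation.Binary.PropositionalEquality
open import Defs

Decreasing : List ℕ → Set
Decreasing = Linked (λ a b → b ≤ a)

Positive : List ℕ → Set
Positive = All (λ a → 0 < a)

part-step : ∀ {xs} → Decreasing xs → ∀ i → part xs (suc (suc i)) ≤ part xs (suc i)
part-step {[]} _ i = z≤n
part-step {x ∷ []} _ zero = z≤n
part-step {x ∷ []} _ (suc i) = z≤n
part-step {x ∷ y ∷ xs} (y≤x ∷ _) zero = y≤x
part-step {x ∷ y ∷ xs} (_ ∷ d) (suc i) = part-step d i

part-mono : ∀ {xs} → Decreasing xs → ∀ {i j} → 1 ≤ i → i ≤ j → part xs j ≤ part xs i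
part-mono {xs} d {suc i} {j} _ i≤j =
  subst (λ z → part xs z ≤ part xs (suc i)) (m+[n∸m]≡n i≤j) (descend (j ∸ suc i))
  where
  descend : ∀ e → part xs (suc i + e) ≤ part xs (suc i)
  descend zero = ≤-reflexive (cong (part xs) (+-identityʳ (suc i)))
  descend (suc e) = ≤-trans (subst (λ z → part xs z ≤ part xs (suc (i + e)))
                              (sym (+-suc (suc i) e)) (part-step d (i + e)))
                            (descend e)

decreasing-from-parts : ∀ xs → (∀ i → part xs (suc (suc i)) ≤ part xs (suc i)) → Decreasing xs
decreasing-from-parts [] _ = []
decreasing-from-parts (x ∷ []) _ = [-]
decreasing-from-parts (x ∷ y ∷ xs) step = step 0 ∷ decreasing-from-parts (y ∷ xs) (λ i → step (suc i))

-- A list of positive numbers is determined by its parts (trailing parts are 0).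
parts-ext : ∀ {xs ys} → Positive xs → Positive ys → (∀ i → part xs (suc i) ≡ part ys (suc i)) → xs ≡ ys
parts-ext [] [] _ = refl
parts-ext [] (y>0 ∷ _) eq = ⊥-elim (<-irrefl (eq 0) y>0)
parts-ext (x>0 ∷ _) [] eq = ⊥-elim (<-irrefl (sym (eq 0)) x>0)
parts-ext (_ ∷ xs>0) (_ ∷ ys>0) eq = cong₂ _∷_ (eq 0) (parts-ext xs>0 ys>0 (λ i → eq (suc i)))

part-beyond : ∀ xs i → length xs < i → part xs i ≡ 0
part-beyond [] i _ = refl
part-beyond (x ∷ xs) (suc (suc i)) (s≤s p) = part-beyond xs (suc i) p

part-≤-head : ∀ {x xs} → Decreasing (x ∷ xs) → ∀ i → part xs i ≤ x
part-≤-head {x} {[]} _ i = z≤n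
part-≤-head {x} {y ∷ xs} _ zero = z≤n
part-≤-head {x} {y ∷ xs} d (suc i) = part-mono d {1} {suc (suc i)} (s≤s z≤n) (s≤s z≤n)

conj-here : ∀ {x xs s} → s ≤ x → conj (x ∷ xs) s ≡ suc (conj xs s)
conj-here {x} {xs} {s} p = cong length (filter-accept (s ≤?_) {x} {xs} p)

conj-skip : ∀ {x xs s} → ¬ s ≤ x → conj (x ∷ xs) s ≡ conj xs s
conj-skip {x} {xs} {s} p = cong length (filter-reject (s ≤?_) {x} {xs} p)

conj-lower : ∀ xs → Decreasing xs → ∀ s y → 1 ≤ y → y ≤ conj xs s → s ≤ part xs y
conj-lower [] d s (suc y) _ ()
conj-lower (x ∷ xs) d s y y≥1 y≤ with s ≤? x
conj-lower (x ∷ xs) d s (suc zero) _ _ | yes s≤x = s≤x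
conj-lower (x ∷ xs) d s (suc (suc y)) _ y≤ | yes s≤x with subst (suc (suc y) ≤_) (conj-here {x} {xs} s≤x) y≤
... | s≤s y≤′ = conj-lower xs (Linked.tail d) s (suc y) (s≤s z≤n) y≤′
conj-lower (x ∷ xs) d s y y≥1 y≤ | no s≰x =
  ⊥-elim (s≰x (≤-trans (conj-lower xs (Linked.tail d) s y y≥1 (subst (y ≤_) (conj-skip {x} {xs} s≰x) y≤))
                       (part-≤-head d y)))

conj-upper : ∀ xs → Decreasing xs → ∀ s → 1 ≤ s → part xs (suc (conj xs s)) < s
conj-upper [] d s s≥1 = s≥1
conj-upper (x ∷ xs) d s s≥1 with s ≤? x
... | yes s≤x rewrite conj-here {x} {xs} s≤x = conj-upper xs (Linked.tail d) s s≥1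
... | no s≰x rewrite conj-skip {x} {xs} s≰x with conj xs s in eq
...   | zero = ≰⇒> s≰x
...   | suc _ = ⊥-elim (s≰x (≤-trans (conj-lower xs (Linked.tail d) s 1 (s≤s z≤n)
                                        (subst (1 ≤_) (sym eq) (s≤s z≤n)))
                                      (part-≤-head d 1)))

conj-≥ : ∀ {xs} → Decreasing xs → ∀ {s y} → 1 ≤ s → 1 ≤ y → s ≤ part xs y → y ≤ conj xs s
conj-≥ {xs} d {s} {y} s≥1 y≥1 s≤ = ≮⇒≥ λ conj<y →
  <⇒≱ (conj-upper xs d s s≥1) (≤-trans s≤ (part-mono d (s≤s z≤n) conj<y))

conj-unique : ∀ xs → Decreasing xs → ∀ s K → 1 ≤ s →
  (∀ y → 1 ≤ y → y ≤ K → s ≤ part xs y) → part xs (suc K) < s → conj xs s ≡ K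
conj-unique xs d s K s≥1 long short with <-cmp (conj xs s) K
... | tri≈ _ eq _ = eq
... | tri< lt _ _ = ⊥-elim (<⇒≱ (conj-upper xs d s s≥1) (long (suc (conj xs s)) (s≤s z≤n) lt))
... | tri> _ _ gt = ⊥-elim (<⇒≱ short (conj-lower xs d s (suc K) (s≤s z≤n) gt))

durfeeFrom-sound : ∀ xs i d → d ≤ durfeeFrom i xs → 1 ≤ d → i + d ≤ suc (part xs d)
durfeeFrom-sound [] i (suc d) () _
durfeeFrom-sound (x ∷ xs) i d d≤ d≥1 with i ≤? x
durfeeFrom-sound (x ∷ xs) i (suc zero) _ _ | yes i≤x rewrite +-comm i 1 = s≤s i≤x
durfeeFrom-sound (x ∷ xs) i (suc (suc d)) (s≤s d≤) _ | yes i≤x rewrite +-suc i (suc d) =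
  durfeeFrom-sound xs (suc i) (suc d) d≤ (s≤s z≤n)
durfeeFrom-sound (x ∷ xs) i (suc d) () _ | no _

durfeeFrom-complete : ∀ xs → Decreasing xs → ∀ i d → 1 ≤ i → 1 ≤ d →
  i + d ≤ suc (part xs d) → d ≤ durfeeFrom i xs
durfeeFrom-complete [] _ (suc i) (suc d) _ _ p with m+n≤o⇒n≤o i (≤-pred p)
... | ()
durfeeFrom-complete (x ∷ xs) dec i d _ _ p with i ≤? x
durfeeFrom-complete (x ∷ xs) dec i (suc zero) _ _ _ | yes _ = s≤s z≤n
durfeeFrom-complete (x ∷ xs) dec i (suc (suc d)) _ _ p | yes _ =
  s≤s (durfeeFrom-complete xs (Linked.tail dec) (suc i) (suc d) (s≤s z≤n) (s≤s z≤n)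
        (subst (_≤ suc (part xs (suc d))) (+-suc i (suc d)) p))
durfeeFrom-complete (x ∷ xs) dec i (suc d) _ _ p | no i≰x =
  ⊥-elim (i≰x (m+n≤o⇒m≤o i (≤-pred (begin
    suc (i + d)                 ≡⟨ +-suc i d ⟨
    i + suc d                   ≤⟨ p ⟩
    suc (part (x ∷ xs) (suc d)) ≤⟨ s≤s (part-mono dec {1} {suc d} (s≤s z≤n) (s≤s z≤n)) ⟩
    suc x                       ∎))))
  where open ≤-Reasoning

durfee-sound : ∀ {xs s} → s ≤ durfee xs → 1 ≤ s → s ≤ part xs s
durfee-sound {xs} {s} s≤D s≥1 = ≤-pred (durfeeFrom-sound xs 1 s s≤D s≥1)

durfee-complete : ∀ {xs s} → Decreasing xs → 1 ≤ s → s ≤ part xs s → s ≤ durfee xs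
durfee-complete {xs} {s} d s≥1 s≤ = durfeeFrom-complete xs d 1 s (s≤s z≤n) s≥1 (s≤s s≤)

dropZeros : List ℕ → List ℕ
dropZeros = filter (0 <?_)

dropZeros-positive : ∀ xs → Positive (dropZeros xs)
dropZeros-positive = all-filter (0 <?_)

dropZeros-decreasing : ∀ {xs} → Decreasing xs → Decreasing (dropZeros xs)
dropZeros-decreasing = LinkedP.filter⁺ (0 <?_) (λ b≤a c≤b → ≤-trans c≤b b≤a)

zeros-after-zero : ∀ {ys} → Decreasing (0 ∷ ys) → All (_≡ 0) ys
zeros-after-zero {[]} _ = []
zeros-after-zero {y ∷ ys} (z≤n ∷ d) = refl ∷ zeros-after-zero d

dropZeros-zeros : ∀ {ys} → All (_≡ 0) ys → dropZeros ys ≡ []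
dropZeros-zeros [] = refl
dropZeros-zeros {_ ∷ ys} (refl ∷ z) = trans (filter-reject (0 <?_) {0} {ys} (λ ())) (dropZeros-zeros z)

part-zeros : ∀ {ys} → All (_≡ 0) ys → ∀ i → part ys i ≡ 0
part-zeros [] i = refl
part-zeros (_ ∷ _) zero = refl
part-zeros (y≡0 ∷ _) (suc zero) = y≡0
part-zeros (_ ∷ z) (suc (suc i)) = part-zeros z (suc i)

-- In a decreasing list the zero parts form a suffix, so dropping them keeps all parts.
dropZeros-part : ∀ {xs} → Decreasing xs → ∀ i → part (dropZeros xs) i ≡ part xs i
dropZeros-part {[]} _ i = refl
dropZeros-part {x ∷ xs} d i with 0 <? x
... | yes x>0 rewrite filter-accept (0 <?_) {x} {xs} x>0 = same-tail i
  where
  same-tail : ∀ i → part (x ∷ dropZeros xs) i ≡ part (x ∷ xs) i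
  same-tail zero = refl
  same-tail (suc zero) = refl
  same-tail (suc (suc i)) = dropZeros-part (Linked.tail d) (suc i)
... | no x≯0 with x
...   | suc _ = ⊥-elim (x≯0 (s≤s z≤n))
...   | zero rewrite filter-reject (0 <?_) {0} {xs} x≯0 | dropZeros-zeros (zeros-after-zero d) =
  sym (part-zeros (refl ∷ zeros-after-zero d) i)

mapPrefix : ℕ → (ℕ → ℕ) → List ℕ → List ℕ
mapPrefix k f xs = map f (take k xs) ++ drop k xs

mapPrefix-low : ∀ k xs (f : ℕ → ℕ) y → k ≤ length xs → 1 ≤ y → y ≤ k →
  part (mapPrefix k f xs) y ≡ f (part xs y)
mapPrefix-low (suc k) (x ∷ xs) f (suc zero) _ _ _ = refl
mapPrefix-low (suc k) (x ∷ xs) f (suc (suc y)) (s≤s k≤) _ (s≤s y≤) = mapPrefix-low k xs f (suc y) k≤ (s≤s z≤n) y≤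

mapPrefix-high : ∀ k xs (f : ℕ → ℕ) y → k ≤ length xs → k < y → part (mapPrefix k f xs) y ≡ part xs y
mapPrefix-high zero xs f y _ _ = refl
mapPrefix-high (suc k) (x ∷ xs) f (suc (suc y)) (s≤s k≤) (s≤s k<) = mapPrefix-high k xs f (suc y) k≤ k<

-- Gluing c columns of height k onto a list: c is added to its first k parts
-- (reading missing parts as 0).
head₀ : List ℕ → ℕ
head₀ [] = 0
head₀ (x ∷ _) = x

tail₀ : List ℕ → List ℕ
tail₀ [] = []
tail₀ (_ ∷ xs) = xs

addColumns : ℕ → ℕ → List ℕ → List ℕ
addColumns zero c xs = xs
addColumns (suc k) c xs = (head₀ xs + c) ∷ addColumns k c (tail₀ xs)

part-tail₀ : ∀ xs i → part xs (suc (suc i)) ≡ part (tail₀ xs) (suc i)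
part-tail₀ [] i = refl
part-tail₀ (x ∷ xs) i = refl

addColumns-low : ∀ k c xs y → 1 ≤ y → y ≤ k → part (addColumns k c xs) y ≡ part xs y + c
addColumns-low (suc k) c [] (suc zero) _ _ = refl
addColumns-low (suc k) c (x ∷ xs) (suc zero) _ _ = refl
addColumns-low (suc k) c xs (suc (suc y)) _ (s≤s y≤k) =
  trans (addColumns-low k c (tail₀ xs) (suc y) (s≤s z≤n) y≤k) (cong (_+ c) (sym (part-tail₀ xs y)))

addColumns-high : ∀ k c xs y → k < y → part (addColumns k c xs) y ≡ part xs y
addColumns-high zero c xs y _ = refl
addColumns-high (suc k) c xs (suc (suc y)) (s≤s k<y) =
  trans (addColumns-high k c (tail₀ xs) (suc y) k<y) (sym (part-tail₀ xs y))

addColumns-positive : ∀ k c xs → 0 < c → Positive xs → Positive (addColumns k c xs)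
addColumns-positive zero c xs _ pos = pos
addColumns-positive (suc k) c xs c>0 pos =
  ≤-trans c>0 (m≤n+m c (head₀ xs)) ∷ addColumns-positive k c (tail₀ xs) c>0 (positive-tail pos)
  where
  positive-tail : ∀ {ys} → Positive ys → Positive (tail₀ ys)
  positive-tail [] = []
  positive-tail (_ ∷ p) = p

addColumns-decreasing : ∀ k c {xs} → Decreasing xs → Decreasing (addColumns k c xs)
addColumns-decreasing k c {xs} d = decreasing-from-parts _ step
  where
  step : ∀ y → part (addColumns k c xs) (suc (suc y)) ≤ part (addColumns k c xs) (suc y)
  step y with suc (suc y) ≤? k | suc y ≤? k
  ... | yes y+2≤k | _
    rewrite addColumns-low k c xs (suc (suc y)) (s≤s z≤n) y+2≤k
          | addColumns-low k c xs (suc y) (s≤s z≤n) (≤-trans (n≤1+n _) y+2≤k) =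
    +-monoˡ-≤ c (part-step d y)
  ... | no y+2≰k | yes y+1≤k
    rewrite addColumns-high k c xs (suc (suc y)) (≰⇒> y+2≰k)
          | addColumns-low k c xs (suc y) (s≤s z≤n) y+1≤k =
    ≤-trans (part-step d y) (m≤m+n _ c)
  ... | no y+2≰k | no y+1≰k
    rewrite addColumns-high k c xs (suc (suc y)) (≰⇒> y+2≰k)
          | addColumns-high k c xs (suc y) (≰⇒> y+1≰k) = part-step d y

sum-head-tail : ∀ ys → sum ys ≡ head₀ ys + sum (tail₀ ys)
sum-head-tail [] = refl
sum-head-tail (y ∷ ys) = refl

addColumns-sum : ∀ k c xs → sum (addColumns k c xs) ≡ sum xs + k * c
addColumns-sum zero c xs = sym (+-identityʳ (sum xs))
addColumns-sum (suc k) c xs rewrite addColumns-sum k c (tail₀ xs) | sum-head-tail xs =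
  regroup (head₀ xs) c (sum (tail₀ xs)) k
  where
  regroup : ∀ a c s k → a + c + (s + k * c) ≡ a + s + (c + k * c)
  regroup = solve-∀

addColumns-cancel : ∀ {k c xs ys} → Positive xs → Positive ys → addColumns k c xs ≡ addColumns k c ys → xs ≡ ys
addColumns-cancel {k} {c} {xs} {ys} xs>0 ys>0 eq = parts-ext xs>0 ys>0 same
  where
  same : ∀ y → part xs (suc y) ≡ part ys (suc y)
  same y with suc y ≤? k
  ... | yes y<k = +-cancelʳ-≡ _ _ _ (trans (sym (addColumns-low k c xs (suc y) (s≤s z≤n) y<k))
                     (trans (cong (λ l → part l (suc y)) eq) (addColumns-low k c ys (suc y) (s≤s z≤n) y<k)))
  ... | no y≮k = trans (sym (addColumns-high k c xs (suc y) (≰⇒> y≮k)))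
                   (trans (cong (λ l → part l (suc y)) eq) (addColumns-high k c ys (suc y) (≰⇒> y≮k)))

replicate-decreasing : ∀ n (K : ℕ) → Decreasing (replicate n K)
replicate-decreasing zero K = []
replicate-decreasing (suc zero) K = [-]
replicate-decreasing (suc (suc n)) K = ≤-refl ∷ replicate-decreasing (suc n) K

replicate-sum : ∀ n K → sum (replicate n K) ≡ n * K
replicate-sum zero K = refl
replicate-sum (suc n) K = cong (λ z → K + z) (replicate-sum n K)

applyUpTo-constant : ∀ n (f : ℕ → ℕ) K → (∀ x → x < n → f x ≡ K) → applyUpTo f n ≡ replicate n K
applyUpTo-constant zero f K _ = refl
applyUpTo-constant (suc n) f K const =
  cong₂ _∷_ (const 0 (s≤s z≤n)) (applyUpTo-constant n (λ x → f (suc x)) K (λ x x<n → const (suc x) (s≤s x<n)))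

replicate-injective : ∀ {a b K K′} → replicate (suc a) K ≡ replicate (suc b) K′ → a ≡ b × K ≡ K′
replicate-injective {a} {b} eq =
  suc-injective (trans (sym (length-replicate (suc a))) (trans (cong length eq) (length-replicate (suc b)))) ,
  cong head₀ eq

constant-list : ∀ {β K} → All (λ x → x ≡ part β 1) β → part β 1 ≡ K → 1 ≤ K →
  Σ ℕ λ c → β ≡ replicate (suc c) K
constant-list {[]} _ refl ()
constant-list {b ∷ bs} (_ ∷ rest) refl _ = length bs , cong (b ∷_) (all-equal rest)
  where
  all-equal : ∀ {xs} → All (_≡ b) xs → xs ≡ replicate (length xs) b
  all-equal [] = refl
  all-equal (refl ∷ a) = cong (b ∷_) (all-equal a)

bounded-max : (P : ℕ → Set) → (∀ h → Dec (P h)) → P 0 → ∀ B →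
  Σ ℕ λ h → P h × (∀ h′ → h′ ≤ B → P h′ → h′ ≤ h)
bounded-max P P? p0 zero = 0 , p0 , λ { .0 z≤n _ → z≤n }
bounded-max P P? p0 (suc B) with P? (suc B)
... | yes pB = suc B , pB , λ h′ h′≤ _ → h′≤
... | no ¬pB with bounded-max P P? p0 B
...   | h , ph , largest = h , ph , below
  where
  below : ∀ h′ → h′ ≤ suc B → P h′ → h′ ≤ h
  below h′ h′≤ ph′ with m≤n⇒m<n∨m≡n h′≤
  ... | inj₁ h′<  = largest h′ (≤-pred h′<) ph′
  ... | inj₂ refl = ⊥-elim (¬pB ph′)

-- The entry of the rank-set at position i is i - α_{i+1}, also beyond the length of α.
rank : List ℕ → ℕ → ℤ
rank α i = + i Z.- + part α (suc i)

rankSet-rank : ∀ α i → rankSet α i ≡ rank α i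
rankSet-rank α i with suc i ≤? length α
... | yes _ = refl
... | no i≥ℓ rewrite part-beyond α (suc i) (≰⇒> i≥ℓ) = sym (ZP.+-identityʳ (+ i))

difference-injective : ∀ a b c d → + a Z.- + b ≡ + c Z.- + d → a + d ≡ c + b
difference-injective a b c d eq = ZP.+-injective (begin
  + (a + d)                       ≡⟨ ZP.pos-+ a d ⟩
  + a Z.+ + d                     ≡⟨ add-back (+ a) (+ b) (+ d) ⟩
  ((+ a Z.- + b) Z.+ + d) Z.+ + b ≡⟨ cong (λ z → (z Z.+ + d) Z.+ + b) eq ⟩
  ((+ c Z.- + d) Z.+ + d) Z.+ + b ≡⟨ cancel (+ c) (+ d) (+ b) ⟩
  + c Z.+ + b                     ≡⟨ ZP.pos-+ c b ⟨
  + (c + b)                       ∎)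
  where
  open ≡-Reasoning
  add-back : ∀ (A B D : ℤ) → A Z.+ D ≡ ((A Z.- B) Z.+ D) Z.+ B
  add-back = ZR.solve-∀
  cancel : ∀ (C D B : ℤ) → ((C Z.- D) Z.+ D) Z.+ B ≡ C Z.+ B
  cancel = ZR.solve-∀

-- For a decreasing α, i ↦ i - α_{i+1} is strictly increasing, hence injective.
rank-injective : ∀ {α} → Decreasing α → ∀ {i i′} → rank α i ≡ rank α i′ → i ≡ i′
rank-injective {α} d {i} {i′} eq with <-cmp i i′ | difference-injective i (part α (suc i)) i′ (part α (suc i′)) eq
... | tri≈ _ i≡i′ _ | _ = i≡i′
... | tri< i<i′ _ _ | e = ⊥-elim (<-irrefl e (≤-<-trans (+-monoʳ-≤ i (part-mono d (s≤s z≤n) (s≤s (<⇒≤ i<i′))))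
                                                       (+-monoˡ-< _ i<i′)))
... | tri> _ _ i>i′ | e = ⊥-elim (<-irrefl (sym e) (≤-<-trans (+-monoʳ-≤ i′ (part-mono d (s≤s z≤n) (s≤s (<⇒≤ i>i′))))
                                                             (+-monoˡ-< _ i>i′)))

-- The integer identity behind the spt-crank of a block: (i+1) - (a+d+1) + (s+d) - s = i - a.
crank-arith : ∀ i a s d → ((+ (i + 1) Z.- + (a + suc d)) Z.+ + (s + d)) Z.- + s ≡ + i Z.- + a
crank-arith i a s d rewrite ZP.pos-+ i 1 | ZP.pos-+ a (suc d) | ZP.pos-+ s d | ZP.pos-+ 1 d =
  cancel (+ i) (+ a) (+ s) (+ d)
  where
  cancel : ∀ (I A S D : ℤ) → (((I Z.+ Z.1ℤ) Z.- (A Z.+ (Z.1ℤ Z.+ D))) Z.+ (S Z.+ D)) Z.- S ≡ I Z.- A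
  cancel = ZR.solve-∀

ψ₁ ψ₂ : List ℕ → ℕ → ℕ → List ℕ
ψ₁ la s t = proj₁ (psi la s t)
ψ₂ la s t = proj₂ (psi la s t)

shift : ℕ → ℕ → ℕ → ℕ
shift s t x = ((x ∸ t) + s) ∸ 1

shift-mono : ∀ s t {x y} → x ≤ y → shift s t x ≤ shift s t y
shift-mono s t x≤y = ∸-monoˡ-≤ 1 (+-monoˡ-≤ s (∸-monoˡ-≤ t x≤y))

shift-at-t : ∀ s t → shift s t t ≡ s ∸ 1
shift-at-t s t = cong (λ z → (z + s) ∸ 1) (n∸n≡0 t)

shift-inverse : ∀ {s t y} → 1 ≤ s → s ≤ t → t ≤ y → shift s t y + suc (t ∸ s) ≡ y
shift-inverse {suc s′} _ s≤t t≤y with m≤n⇒∃[o]m+o≡n s≤t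
... | d , refl with m≤n⇒∃[o]m+o≡n t≤y
...   | e , refl rewrite m+n∸m≡n (suc s′ + d) e | +-suc e s′ | m+n∸m≡n (suc s′) d = regroup e s′ d
  where
  regroup : ∀ e s d → e + s + suc d ≡ suc (s + d + e)
  regroup = solve-∀

below-pred : ∀ {a s} → a < s → a ≤ s ∸ 1
below-pred {s = suc s} (s≤s a≤s) = a≤s

-- A block of equal columns: in λ the first k parts are ≥ t and the next is < s,
-- so each of the columns s, …, t has length k.
record ColumnBlock (la : List ℕ) (s t k : ℕ) : Set where
  field
    decreasing : Decreasing la
    s-positive : 1 ≤ s
    s≤t        : s ≤ t
    long-rows  : ∀ y → 1 ≤ y → y ≤ k → t ≤ part la y
    short-row  : part la (suc k) < s

-- What ψ does to a block of equal columns: it removes the block.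
module BlockFacts {la s t k} (B : ColumnBlock la s t k) where
  open ColumnBlock B

  block-conj : ∀ u → s ≤ u → u ≤ t → conj la u ≡ k
  block-conj u s≤u u≤t = conj-unique la decreasing u k (≤-trans s-positive s≤u)
    (λ y y≥1 y≤k → ≤-trans u≤t (long-rows y y≥1 y≤k)) (<-≤-trans short-row s≤u)

  block-β : ψ₂ la s t ≡ replicate (suc (t ∸ s)) k
  block-β = applyUpTo-constant (suc (t ∸ s)) (λ x → conj la (s + x)) k
    (λ x x≤t-s → block-conj (s + x) (m≤m+n s x)
       (≤-trans (+-monoʳ-≤ s (≤-pred x≤t-s)) (≤-reflexive (m+[n∸m]≡n s≤t))))

  private
    cut : List ℕ
    cut = mapPrefix k (shift s t) la

    k≤ℓ : k ≤ length la
    k≤ℓ = subst (_≤ length la) (block-conj s ≤-refl s≤t) (length-filter (s ≤?_) la)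

    cut-low : ∀ y → 1 ≤ y → y ≤ k → part cut y ≡ shift s t (part la y)
    cut-low y = mapPrefix-low k la (shift s t) y k≤ℓ

    cut-high : ∀ y → k < y → part cut y ≡ part la y
    cut-high y = mapPrefix-high k la (shift s t) y k≤ℓ

    -- Shifted rows stay ≥ s - 1 > λ_{k+1}, so the cut list is still decreasing.
    cut-step : ∀ y → part cut (suc (suc y)) ≤ part cut (suc y)
    cut-step y with suc (suc y) ≤? k | suc y ≤? k
    ... | yes y+2≤k | _
      rewrite cut-low (suc (suc y)) (s≤s z≤n) y+2≤k | cut-low (suc y) (s≤s z≤n) (≤-trans (n≤1+n _) y+2≤k) =
      shift-mono s t (part-step decreasing y)
    ... | no y+2≰k | yes y+1≤k rewrite cut-high (suc (suc y)) (≰⇒> y+2≰k) | cut-low (suc y) (s≤s z≤n) y+1≤k =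
      ≤-trans (part-mono decreasing (s≤s z≤n) (≰⇒> y+2≰k))
        (≤-trans (below-pred short-row)
          (≤-trans (≤-reflexive (sym (shift-at-t s t))) (shift-mono s t (long-rows (suc y) (s≤s z≤n) y+1≤k))))
    ... | no y+2≰k | no y+1≰k rewrite cut-high (suc (suc y)) (≰⇒> y+2≰k) | cut-high (suc y) (≰⇒> y+1≰k) =
      part-step decreasing y

    cut-decreasing : Decreasing cut
    cut-decreasing = decreasing-from-parts cut cut-step

    α≡cut : ψ₁ la s t ≡ dropZeros cut
    α≡cut = cong (λ k′ → dropZeros (mapPrefix k′ (shift s t) la)) (block-conj s ≤-refl s≤t)

    α-part : ∀ y → part (ψ₁ la s t) y ≡ part cut y
    α-part y = trans (cong (λ l → part l y) α≡cut) (dropZeros-part cut-decreasing y)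

  α-low : ∀ y → 1 ≤ y → y ≤ k → part (ψ₁ la s t) y ≡ shift s t (part la y)
  α-low y y≥1 y≤k = trans (α-part y) (cut-low y y≥1 y≤k)

  α-high : ∀ y → k < y → part (ψ₁ la s t) y ≡ part la y
  α-high y k<y = trans (α-part y) (cut-high y k<y)

  α-partition : IsPartition (ψ₁ la s t)
  α-partition = subst Decreasing (sym α≡cut) (dropZeros-decreasing cut-decreasing) ,
                dropZeros-positive (mapPrefix (conj la s) (shift s t) la)

  α-plus-block : ∀ y → 1 ≤ y → y ≤ k → part (ψ₁ la s t) y + suc (t ∸ s) ≡ part la y
  α-plus-block y y≥1 y≤k = trans (cong (_+ suc (t ∸ s)) (α-low y y≥1 y≤k))
                                 (shift-inverse s-positive s≤t (long-rows y y≥1 y≤k))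

  block-reassemble : Positive la → la ≡ addColumns k (suc (t ∸ s)) (ψ₁ la s t)
  block-reassemble la>0 = parts-ext la>0 (addColumns-positive k _ _ (s≤s z≤n) (proj₂ α-partition)) same
    where
    same : ∀ y → part la (suc y) ≡ part (addColumns k (suc (t ∸ s)) (ψ₁ la s t)) (suc y)
    same y with suc y ≤? k
    ... | yes y<k = trans (sym (α-plus-block (suc y) (s≤s z≤n) y<k)) (sym (addColumns-low k _ _ (suc y) (s≤s z≤n) y<k))
    ... | no y≮k = trans (sym (α-high (suc y) (≰⇒> y≮k))) (sym (addColumns-high k _ _ (suc y) (≰⇒> y≮k)))

  -- If k = i + s, then g = λ'_s - s + 1 = i + 1 and the spt-crank is the rank entry i - α_{i+1}.
  block-crank : ∀ i → k ≡ i + s → sptCrank la s t ≡ rank (ψ₁ la s t) i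
  block-crank i k≡ = begin
    sptCrank la s t                                           ≡⟨ cong crank-at g≡ ⟩
    crank-at (i + 1)                                          ≡⟨ cong (λ p → ((+ (i + 1) Z.- + p) Z.+ + t) Z.- + s) row ⟩
    ((+ (i + 1) Z.- + (a + suc d)) Z.+ + t) Z.- + s           ≡⟨ cong (λ z → ((+ (i + 1) Z.- + (a + suc d)) Z.+ + z) Z.- + s) t≡ ⟩
    ((+ (i + 1) Z.- + (a + suc d)) Z.+ + (s + d)) Z.- + s     ≡⟨ crank-arith i a s d ⟩
    rank (ψ₁ la s t) i                                        ∎
    where
    open ≡-Reasoning
    d = t ∸ s
    a = part (ψ₁ la s t) (suc i)
    crank-at : ℕ → ℤ
    crank-at g = ((+ g Z.- + part la g) Z.+ + t) Z.- + s
    g≡ : (conj la s ∸ s) + 1 ≡ i + 1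
    g≡ = cong (_+ 1) (trans (cong (_∸ s) (trans (block-conj s ≤-refl s≤t) k≡)) (m+n∸n≡m i s))
    i+1≤k : suc i ≤ k
    i+1≤k = subst (suc i ≤_) (sym k≡) (subst (_≤ i + s) (+-comm i 1) (+-monoʳ-≤ i s-positive))
    row : part la (i + 1) ≡ a + suc d
    row = trans (cong (part la) (+-comm i 1)) (sym (α-plus-block (suc i) (s≤s z≤n) i+1≤k))
    t≡ : t ≡ s + d
    t≡ = sym (m+[n∸m]≡n s≤t)

record Admissible (α : List ℕ) (i h : ℕ) : Set where
  field
    partition : IsPartition α
    h-fits    : h ≤ part α (i + suc h)
    h-maximal : part α (suc (i + suc h)) < suc h

block-admissible : ∀ {la h t i} → ColumnBlock la (suc h) t (i + suc h) → Admissible (ψ₁ la (suc h) t) i h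
block-admissible {la} {h} {t} {i} B = record
  { partition = α-partition
  ; h-fits    = subst (h ≤_) (sym (α-low K K≥1 ≤-refl))
                  (subst (_≤ shift (suc h) t (part la K)) (shift-at-t (suc h) t)
                    (shift-mono (suc h) t (long-rows K K≥1 ≤-refl)))
  ; h-maximal = subst (_< suc h) (sym (α-high (suc K) ≤-refl)) short-row
  }
  where
  open ColumnBlock B
  open BlockFacts B
  K = i + suc h
  K≥1 : 1 ≤ K
  K≥1 = ≤-trans (s≤s z≤n) (m≤n+m (suc h) i)

-- The common description of Q_{m,n} and V_{m,n}: β = (K,…,K), c + 1 times, for an
-- admissible (α, i, h) with K = i + 1 + h; m is the rank-set entry i - α_{i+1}; |α| + |β| = n.
record Glued (m : ℤ) (n : ℕ) (α β : List ℕ) : Set where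
  constructor glued
  field
    i h c      : ℕ
    admissible : Admissible α i h
    m≡rank     : m ≡ rank α i
    β≡         : β ≡ replicate (suc c) (i + suc h)
    size       : sum α + sum β ≡ n

-- (i, h, c) is determined by (m, α, β): c and K by β, then i by injectivity of the rank.
glued-unique : ∀ {m n α β α′ β′} (g : Glued m n α β) (g′ : Glued m n α′ β′) → α ≡ α′ → β ≡ β′ →
  Glued.i g ≡ Glued.i g′ × Glued.h g ≡ Glued.h g′ × Glued.c g ≡ Glued.c g′
glued-unique (glued i h c A refl refl _) (glued i′ h′ c′ _ m≡′ refl _) refl β≡β′ =
  i≡i′ , suc-injective (+-cancelˡ-≡ i _ _ (trans K≡K′ (cong (_+ suc h′) (sym i≡i′)))) , c≡c′
  where
  i≡i′ : i ≡ i′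
  i≡i′ = rank-injective (proj₁ (Admissible.partition A)) m≡′
  c≡c′ : c ≡ c′
  c≡c′ = proj₁ (replicate-injective β≡β′)
  K≡K′ : i + suc h ≡ i′ + suc h′
  K≡K′ = proj₂ (replicate-injective β≡β′)

glued-size : ∀ K c α → sum (addColumns K (suc c) α) ≡ sum α + sum (replicate (suc c) K)
glued-size K c α = trans (addColumns-sum K (suc c) α)
  (cong (λ z → sum α + z) (trans (*-comm K (suc c)) (sym (replicate-sum (suc c) K))))

glued-block : ∀ {α i h} → Admissible α i h → ∀ c →
  ColumnBlock (addColumns (i + suc h) (suc c) α) (suc h) (suc h + c) (i + suc h)
glued-block {α} {i} {h} A c = record
  { decreasing = addColumns-decreasing K (suc c) (proj₁ partition)
  ; s-positive = s≤s z≤n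
  ; s≤t        = m≤m+n (suc h) c
  ; long-rows  = long
  ; short-row  = subst (_< suc h) (sym (addColumns-high K (suc c) α (suc K) ≤-refl)) h-maximal
  }
  where
  open Admissible A
  K = i + suc h
  long : ∀ y → 1 ≤ y → y ≤ K → suc h + c ≤ part (addColumns K (suc c) α) y
  long y y≥1 y≤K rewrite addColumns-low K (suc c) α y y≥1 y≤K =
    subst (_≤ part α y + suc c) (+-suc h c)
      (+-monoˡ-≤ (suc c) (≤-trans h-fits (part-mono (proj₁ partition) y≥1 y≤K)))

glued-preimage : ∀ {m n α β} → Glued m n α β →
  Σ (List ℕ) λ la → Σ ℕ λ s → Σ ℕ λ t → IsQ m n la s t × psi la s t ≡ (α , β)
glued-preimage {α = α} (glued i h c A refl refl size) =
  la , s , t , ((((decreasing , la>0) , trans (glued-size K c α) size) , s≤s z≤n , s≤D , s≤t , t≤λ₁ , conj≡) , crank≡) ,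
  cong₂ _,_ α≡ β≡
  where
  K = i + suc h
  s = suc h
  t = suc h + c
  la = addColumns K (suc c) α
  B = glued-block A c
  open Admissible A
  open ColumnBlock B
  open BlockFacts B
  t-s≡c : t ∸ s ≡ c
  t-s≡c = m+n∸m≡n (suc h) c
  la>0 : Positive la
  la>0 = addColumns-positive K (suc c) α (s≤s z≤n) (proj₂ partition)
  α≡ : ψ₁ la s t ≡ α
  α≡ = addColumns-cancel (proj₂ α-partition) (proj₂ partition)
         (sym (trans (block-reassemble la>0) (cong (λ d → addColumns K (suc d) (ψ₁ la s t)) t-s≡c)))
  β≡ : ψ₂ la s t ≡ replicate (suc c) K
  β≡ = trans block-β (cong (λ d → replicate (suc d) K) t-s≡c)
  s≤K : s ≤ K
  s≤K = m≤n+m s i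
  s≤D : s ≤ durfee la
  s≤D = durfee-complete decreasing (s≤s z≤n) (≤-trans s≤t (long-rows s (s≤s z≤n) s≤K))
  t≤λ₁ : t ≤ part la 1
  t≤λ₁ = long-rows 1 (s≤s z≤n) (≤-trans (s≤s z≤n) s≤K)
  conj≡ : conj la s ≡ conj la t
  conj≡ = trans (block-conj s ≤-refl s≤t) (sym (block-conj t s≤t ≤-refl))
  crank≡ : sptCrank la s t ≡ rank α i
  crank≡ = trans (block-crank i refl) (cong (λ a → rank a i) α≡)

Reassembles : ∀ {m n α β} → Glued m n α β → List ℕ → ℕ → ℕ → Set
Reassembles {α = α} g la s t = s ≡ suc h × t ≡ suc h + c × la ≡ addColumns (i + suc h) (suc c) α
  where open Glued g

-- Q side, decomposition: the columns s, …, t of a doubly marked partition form a block of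
-- height K = λ'_s ≥ s; removing it gives the glued description of ψ(λ, s, t).
doubly-marked-decomposition : ∀ {m n la s t} → IsQ m n la s t →
  Σ (Glued m n (ψ₁ la s t) (ψ₂ la s t)) λ g → Reassembles g la s t
doubly-marked-decomposition {m} {n} {la} {suc h} {t}
  ((((dec , la>0) , la-size) , _ , s≤D , s≤t , _ , conj≡) , crank≡) =
  glued i h c (block-admissible B) (trans (sym crank≡) (block-crank i refl)) block-β size ,
  refl , sym (m+[n∸m]≡n s≤t) , la≡
  where
  s = suc h
  s≤k : s ≤ conj la s
  s≤k = conj-≥ dec (s≤s z≤n) (s≤s z≤n) (durfee-sound {la} s≤D (s≤s z≤n))
  i = conj la s ∸ s
  c = t ∸ s
  k≡ : conj la s ≡ i + s
  k≡ = sym (m∸n+n≡m s≤k)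
  B : ColumnBlock la s t (i + s)
  B = record
    { decreasing = dec
    ; s-positive = s≤s z≤n
    ; s≤t        = s≤t
    ; long-rows  = λ y y≥1 y≤k → conj-lower la dec t y y≥1 (subst (y ≤_) (trans (sym k≡) conj≡) y≤k)
    ; short-row  = subst (λ z → part la (suc z) < s) k≡ (conj-upper la dec s (s≤s z≤n))
    }
  open BlockFacts B
  la≡ : la ≡ addColumns (i + s) (suc c) (ψ₁ la s t)
  la≡ = block-reassemble la>0
  size : sum (ψ₁ la s t) + sum (ψ₂ la s t) ≡ n
  size = begin
    sum (ψ₁ la s t) + sum (ψ₂ la s t)                      ≡⟨ cong (λ b → sum (ψ₁ la s t) + sum b) block-β ⟩
    sum (ψ₁ la s t) + sum (replicate (suc c) (i + s))      ≡⟨ glued-size (i + s) c (ψ₁ la s t) ⟨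
    sum (addColumns (i + s) (suc c) (ψ₁ la s t))          ≡⟨ cong sum la≡ ⟨
    sum la                                                 ≡⟨ la-size ⟩
    n                                                      ∎
    where open ≡-Reasoning

-- The index j + m + 1 + h of condition (2), for j = α_{i+1} and m = i - α_{i+1}, is K = i + 1 + h.
h-index : ∀ a i h → ((+ a Z.+ (+ i Z.- + a)) Z.+ + 1) Z.+ + h ≡ + (i + suc h)
h-index a i h rewrite ZP.pos-+ i (suc h) | ZP.pos-+ 1 h = regroup (+ a) (+ i) (+ h)
  where
  regroup : ∀ (A I H : ℤ) → ((A Z.+ (I Z.- A)) Z.+ Z.1ℤ) Z.+ H ≡ I Z.+ (Z.1ℤ Z.+ H)
  regroup = ZR.solve-∀

-- For m = i - α_{i+1}, the m-Durfee rectangle of α is the i × α_{i+1} rectangle, and the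
-- maximal h of condition (2) is the h with α_{i+1+h} ≥ h and α_{i+2+h} < h + 1.
module DurfeeRectangle {α : List ℕ} (dec : Decreasing α) (i : ℕ) where
  a : ℕ
  a = part α (suc i)

  -- Rows 1, …, i all have length ≥ α_{i+1}.
  width-fits : RectFits (rank α i) α a
  width-fits = i , rows≡ , λ y _ y≥1 y≤i _ c≤a → ≤-trans c≤a (part-mono dec y≥1 (≤-trans y≤i (n≤1+n i)))
    where
    rows≡ : + i ≡ rank α i Z.+ + a
    rows≡ = add-back (+ i) (+ a)
      where
      add-back : ∀ (I A : ℤ) → I ≡ (I Z.- A) Z.+ A
      add-back = ZR.solve-∀

  -- A wider rectangle would contain row i + 1, which is only α_{i+1} long.
  width-maximal : ∀ j → RectFits (rank α i) α j → j ≤ a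
  width-maximal j (r , r≡ , inside) with j ≤? a
  ... | yes j≤a = j≤a
  ... | no j≰a = ⊥-elim (j≰a (inside (suc i) j (s≤s z≤n) i<r j≥1 ≤-refl))
    where
    a<j : a < j
    a<j = ≰⇒> j≰a
    j≥1 : 1 ≤ j
    j≥1 = ≤-trans (s≤s z≤n) a<j
    r+a≡i+j : r + a ≡ i + j
    r+a≡i+j = ZP.+-injective (begin
      + (r + a)                          ≡⟨ ZP.pos-+ r a ⟩
      + r Z.+ + a                        ≡⟨ cong (Z._+ + a) r≡ ⟩
      ((+ i Z.- + a) Z.+ + j) Z.+ + a    ≡⟨ cancel (+ i) (+ a) (+ j) ⟩
      + i Z.+ + j                        ≡⟨ ZP.pos-+ i j ⟨
      + (i + j)                          ∎)
      where
      open ≡-Reasoning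
      cancel : ∀ (I A J : ℤ) → ((I Z.- A) Z.+ J) Z.+ A ≡ I Z.+ J
      cancel = ZR.solve-∀
    i<r : suc i ≤ r
    i<r = +-cancelʳ-≤ a (suc i) r
      (≤-trans (≤-reflexive (sym (+-suc i a))) (≤-trans (+-monoʳ-≤ i a<j) (≤-reflexive (sym r+a≡i+j))))

  width-is : IsDurfeeRectWidth (rank α i) α a
  width-is = width-fits , width-maximal

  width-unique : ∀ j → IsDurfeeRectWidth (rank α i) α j → j ≡ a
  width-unique j (fits , maximal) = ≤-antisym (width-maximal j fits) (maximal a width-fits)

  hcond-part : ∀ h → HCond (rank α i) α a h → h ≤ part α (i + suc h)
  hcond-part h (idx , idx≡ , h≤) = subst (λ z → h ≤ part α z) (ZP.+-injective (trans idx≡ (h-index a i h))) h≤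

  part-hcond : ∀ h → h ≤ part α (i + suc h) → HCond (rank α i) α a h
  part-hcond h h≤ = i + suc h , sym (h-index a i h) , h≤

  -- If α_{i+2+h} < h + 1, no h′ > h satisfies the condition, since α_{i+1+h′} ≤ α_{i+2+h}.
  beyond-max : ∀ h h′ → part α (suc (i + suc h)) < suc h → suc h ≤ h′ → ¬ (h′ ≤ part α (i + suc h′))
  beyond-max h h′ short h<h′ h′≤ =
    <-irrefl refl (≤-trans (s≤s (≤-trans h′≤ (part-mono dec (s≤s z≤n) index≤))) (≤-trans short h<h′))
    where
    index≤ : suc (i + suc h) ≤ i + suc h′
    index≤ = ≤-trans (≤-reflexive (sym (+-suc i (suc h)))) (+-monoʳ-≤ i (s≤s h<h′))

  maxH-is : ∀ h → h ≤ part α (i + suc h) → part α (suc (i + suc h)) < suc h → IsMaxH (rank α i) α a h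
  maxH-is h h≤ short = part-hcond h h≤ , λ h′ cond → ≮⇒≥ (λ h<h′ → beyond-max h h′ short h<h′ (hcond-part h′ cond))

  maxH-unique : ∀ h h′ → IsMaxH (rank α i) α a h′ → h ≤ part α (i + suc h) → part α (suc (i + suc h)) < suc h → h′ ≡ h
  maxH-unique h h′ (cond , maximal) h≤ short =
    ≤-antisym (≮⇒≥ (λ h<h′ → beyond-max h h′ short h<h′ (hcond-part h′ cond))) (maximal h (part-hcond h h≤))

  -- The maximal h exists: all candidates are bounded by α_1.
  maxH-exists : Σ ℕ λ h → h ≤ part α (i + suc h) × part α (suc (i + suc h)) < suc h
  maxH-exists with bounded-max (λ h → h ≤ part α (i + suc h)) (λ h → h ≤? part α (i + suc h)) z≤n (part α 1)
  ... | h , h≤ , largest = h , h≤ , ≰⇒> next-fails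
    where
    next-fails : ¬ (suc h ≤ part α (suc (i + suc h)))
    next-fails h+1≤ = <-irrefl refl (largest (suc h) (≤-trans h+1≤′ (part-mono dec (s≤s z≤n) (≤-trans (s≤s z≤n) (m≤n+m (suc (suc h)) i)))) h+1≤′)
      where
      h+1≤′ : suc h ≤ part α (i + suc (suc h))
      h+1≤′ = subst (λ z → suc h ≤ part α z) (sym (+-suc i (suc h))) h+1≤

glued-in-V : ∀ {m n α β} → Glued m n α β → IsV m n (α , β)
glued-in-V {α = α} (glued i h c A refl refl size) =
  partition , (replicate-decreasing (suc c) K , replicate⁺ (suc c) K>0) , size ,
  replicate⁺ (suc c) refl , (i , rankSet-rank α i) , condition
  where
  open Admissible A
  open DurfeeRectangle (proj₁ partition) i
  K = i + suc h
  K>0 : 0 < K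
  K>0 = ≤-trans (s≤s z≤n) (m≤n+m (suc h) i)
  condition : ∀ j h′ → IsDurfeeRectWidth (rank α i) α j → IsMaxH (rank α i) α j h′ →
    + K ≡ (((+ j) Z.+ rank α i) Z.+ (+ 1)) Z.+ (+ h′)
  condition j h′ width maxH with width-unique j width
  ... | refl rewrite maxH-unique h h′ maxH h-fits h-maximal = sym (h-index a i h)

-- V side, decomposition: taking i from condition (1) and the maximal h, condition (2)
-- forces β = (K,…,K).
V-decomposition : ∀ {m n α β} → IsV m n (α , β) → Glued m n α β
V-decomposition {m} {n} {α} {β} (α-partition , _ , size , constant , (i , rank≡m) , condition) =
  glued i h (proj₁ β-constant) record { partition = α-partition ; h-fits = h-fits ; h-maximal = h-maximal }
    m≡ (proj₂ β-constant) size
  where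
  open DurfeeRectangle (proj₁ α-partition) i
  m≡ : m ≡ rank α i
  m≡ = trans (sym rank≡m) (rankSet-rank α i)
  h = proj₁ maxH-exists
  h-fits = proj₁ (proj₂ maxH-exists)
  h-maximal = proj₂ (proj₂ maxH-exists)
  β₁≡K : part β 1 ≡ i + suc h
  β₁≡K = ZP.+-injective (begin
    + part β 1                                      ≡⟨ condition a h (subst (λ z → IsDurfeeRectWidth z α a) (sym m≡) width-is)
                                                         (subst (λ z → IsMaxH z α a h) (sym m≡) (maxH-is h h-fits h-maximal)) ⟩
    ((+ a Z.+ m) Z.+ + 1) Z.+ + h                   ≡⟨ cong (λ z → ((+ a Z.+ z) Z.+ + 1) Z.+ + h) m≡ ⟩
    ((+ a Z.+ rank α i) Z.+ + 1) Z.+ + h            ≡⟨ h-index a i h ⟩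
    + (i + suc h)                                   ∎)
    where open ≡-Reasoning
  β-constant : Σ ℕ λ c → β ≡ replicate (suc c) (i + suc h)
  β-constant = constant-list constant β₁≡K (≤-trans (s≤s z≤n) (m≤n+m (suc h) i))

psi-into : ∀ {m n} la s t → IsQ m n la s t → IsV m n (psi la s t)
psi-into la s t q = glued-in-V (proj₁ (doubly-marked-decomposition q))

-- ψ is injective on Q_{m,n}: the glued description of the image determines (λ, s, t).
psi-injective : ∀ {m n} la s t la′ s′ t′ → IsQ m n la s t → IsQ m n la′ s′ t′ →
  psi la s t ≡ psi la′ s′ t′ → (la , s , t) ≡ (la′ , s′ , t′)
psi-injective la s t la′ s′ t′ q q′ same
  with doubly-marked-decomposition q | doubly-marked-decomposition q′
... | g , s≡ , t≡ , la≡ | g′ , s≡′ , t≡′ , la≡′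
  with glued-unique g g′ (cong proj₁ same) (cong proj₂ same)
...   | i≡ , h≡ , c≡ =
  cong₂ _,_ (trans la≡ (trans (reglue i≡ h≡ c≡ (cong proj₁ same)) (sym la≡′)))
    (cong₂ _,_ (trans s≡ (trans (cong suc h≡) (sym s≡′)))
               (trans t≡ (trans (cong₂ (λ h c → suc h + c) h≡ c≡) (sym t≡′))))
  where
  reglue : ∀ {i h c α i′ h′ c′ α′} → i ≡ i′ → h ≡ h′ → c ≡ c′ → α ≡ α′ →
    addColumns (i + suc h) (suc c) α ≡ addColumns (i′ + suc h′) (suc c′) α′
  reglue refl refl refl refl = refl

psi-onto : ∀ {m n} α β → IsV m n (α , β) →
  Σ (List ℕ) λ la → Σ ℕ λ s → Σ ℕ λ t → IsQ m n la s t × psi la s t ≡ (α , β)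
psi-onto α β v = glued-preimage (V-decomposition v)

theorem2p7 : (m : ℤ) (n : ℕ) → 1 ≤ n →
    (∀ la s t → IsQ m n la s t → IsV m n (psi la s t)) ×
    (∀ la s t la′ s′ t′ → IsQ m n la s t → IsQ m n la′ s′ t′ →
       psi la s t ≡ psi la′ s′ t′ → (la , s , t) ≡ (la′ , s′ , t′)) ×
    (∀ α β → IsV m n (α , β) →
       Σ (List ℕ) λ la → Σ ℕ λ s → Σ ℕ λ t → IsQ m n la s t × psi la s t ≡ (α , β))
theorem2p7 m n _ = psi-into , psi-injective , psi-onto
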